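{- Let $r\geq t\geq 3$, $n_1\geq\cdots\geq n_r\geq1$, let $\mathcal{V}=(V_1,\ldots,V_r)$ be a partition of a set $V$ with $|V_i|=n_i$, and let $\mathcal{P}=(P_1,\ldots,P_{t-1})$ be a partition of $V$ into $t-1$ classes which is stable to $\mathcal{V}$. Then the integral part of each class of $\mathcal{P}$ has size at least $n_{t-1}$.
   Context: $V_i$ is integral in $P_j$ if $V_i\subseteq P_j$, partial in $P_j$ if $V_i\cap P_j\neq\emptyset$ and $V_i\not\subseteq P_j$; $V_i$ is a partial class of $\mathcal{V}$ if it is partial in some $P_j$. The integral part of $P_j$ is the union of the $V_i$ integral in $P_j$; the partial part is the union of the $V_i\cap P_j$ with $V_i$ partial in $P_j$. $P_j$ is a partial class if its partial part is nonempty, an integral class otherwise. $\mathcal{P}$ is stable to $\mathcal{V}$ if: (1) each $P_j$ has at most one $V_i$ partial in it; (2) the integral parts of all partial classes of $\mathcal{P}$ have equal size, at most the size of every integral class of $\mathcal{P}$; (3) the integral part of every class of $\mathcal{P}$ has size at least that of every partial class of $\mathcal{V}$; (4) for every $j$ and every $V_i$ integral in $P_j$, $|P_j\setminus V_i|$ is at most the size of the integral part of every $P_{j'}$ with $j'\neq j$. -}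

module Defs where

open import Data.Nat using (ℕ; _≤_)
open import Data.Fin using (Fin; _≟_)
open import Data.Fin.Subset using (Subset; _⊆_; _∩_; _─_; ∣_∣; Nonempty)
open import Data.Fin.Subset.Properties using (_⊆?_)
open import Data.Vec using (tabulate)
open import Data.Bool using (_∧_; not)
open import Data.Product using (_×_; ∃)
open import Relation.Nullary using (¬_; ⌊_⌋)
open import Relation.Binary.PropositionalEquality using (_≡_; _≢_)

-- The ground set V is Fin N.  A partition into r (resp. m) labelled classes is
-- given by a class-assignment function V → Fin r (resp. V → Fin m);
-- class i is the preimage of i.
-- the class V_i as a subset of V
Vcls : {N r : ℕ} → (Fin N → Fin r) → Fin r → Subset N
Vcls cV i = tabulate (λ x → ⌊ cV x ≟ i ⌋)

module _ {N r m : ℕ} (cV : Fin N → Fin r) (cP : Fin N → Fin m) where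

  Pcls : Fin m → Subset N
  Pcls j = tabulate (λ x → ⌊ cP x ≟ j ⌋)

  IntegralIn : Fin r → Fin m → Set
  IntegralIn i j = Vcls cV i ⊆ Pcls j

  PartialIn : Fin r → Fin m → Set
  PartialIn i j = Nonempty (Vcls cV i ∩ Pcls j) × ¬ (Vcls cV i ⊆ Pcls j)

  PartialClassV : Fin r → Set
  PartialClassV i = ∃ λ j → PartialIn i j

  -- integral part of P_j : union of the V_i integral in P_j
  -- (x lies in it iff the 𝒱-class of x is contained in P_j)
  IntPart : Fin m → Subset N
  IntPart j = tabulate (λ x → ⌊ Vcls cV (cV x) ⊆? Pcls j ⌋)

  -- partial part of P_j : union of V_i ∩ P_j over V_i partial in P_j
  -- (x lies in it iff x ∈ P_j and the 𝒱-class of x is not contained in P_j)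
  PartPart : Fin m → Subset N
  PartPart j = tabulate (λ x → ⌊ cP x ≟ j ⌋ ∧ not ⌊ Vcls cV (cV x) ⊆? Pcls j ⌋)

  PartialClassP : Fin m → Set
  PartialClassP j = Nonempty (PartPart j)

  IntegralClassP : Fin m → Set
  IntegralClassP j = ¬ PartialClassP j

  record Stable : Set where
    field
      cond1  : ∀ j i i' → PartialIn i j → PartialIn i' j → i ≡ i'
      cond2a : ∀ j j' → PartialClassP j → PartialClassP j' →
               ∣ IntPart j ∣ ≡ ∣ IntPart j' ∣
      cond2b : ∀ j j' → PartialClassP j → IntegralClassP j' →
               ∣ IntPart j ∣ ≤ ∣ IntPart j' ∣
      cond3  : ∀ j i → PartialClassV i → ∣ Vcls cV i ∣ ≤ ∣ IntPart j ∣
      cond4  : ∀ j i → IntegralIn i j → ∀ j' → j' ≢ j →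
               ∣ Pcls j ─ Vcls cV i ∣ ≤ ∣ IntPart j' ∣

-- Suppose the integral part of P_j had fewer than n_{t-1} elements. Each of
-- V_1, …, V_{t-1} is larger than it, so by condition (3) none of them is a
-- partial class of 𝒱: each is integral in the class of 𝒫 containing it, and
-- that class is not P_j. These t-1 classes of 𝒱 fall into the t-2 classes of
-- 𝒫 other than P_j, so two of them, V_a and V_b, are integral in the same P_p.
-- Then V_b ⊆ P_p ∖ V_a, and condition (4) bounds |P_p ∖ V_a| by the integral
-- part of P_j, which is smaller than V_b. Being large, the V_i are nonempty
-- without appeal to the hypothesis n_i ≥ 1.
module Submission where

open import Defs
open import Data.Nat using (ℕ; suc; _≤_; _<_; _∸_; s≤s; z≤n; _≤?_)
open import Data.Nat.Properties using (≤-trans; <-≤-trans; n≤1+n; ≤-pred; n<1+n; ≰⇒>; <⇒≢; <⇒≱; module ≤-Reasoning)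
open import Data.Fin as Fin using (Fin; toℕ; inject≤; punchOut)
open import Data.Fin.Properties as Finₚ using (toℕ-inject≤; inject≤-injective; punchOut-injective; pigeonhole; toℕ<n)
open import Data.Fin.Subset using (Subset; _∈_; _⊆_; _─_; ∣_∣; Nonempty)
open import Data.Fin.Subset.Properties using (p⊆q⇒∣p∣≤∣q∣; x∈p∩q⁺; x∈p∧x∉q⇒x∈p─q; nonempty?; Empty-unique; ∣⊥∣≡0; _⊆?_)
open import Data.Vec using (tabulate)
open import Data.Vec.Properties using ([]=⇒lookup; lookup⇒[]=; lookup∘tabulate)
open import Data.Bool.Properties using (T-≡)
open import Data.Product using (_,_; proj₁; proj₂)
open import Function using (_∘_)
open import Function.Bundles using (Equivalence)
open import Function.Definitions using (Injective)
open import Level using (0ℓ)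
open import Relation.Nullary using (yes; no; ¬_; ⌊_⌋; contradiction)
open import Relation.Nullary.Decidable using (toWitness; fromWitness; decidable-stable)
open import Relation.Unary using (Pred; Decidable)
open import Relation.Binary.PropositionalEquality using (_≡_; _≢_; refl; sym; trans; subst; ≢-sym)

module _ {N : ℕ} {P : Pred (Fin N) 0ℓ} (P? : Decidable P) where

  ∈-tabulate-isYes⁻ : ∀ {x} → x ∈ tabulate (λ y → ⌊ P? y ⌋) → P x
  ∈-tabulate-isYes⁻ {x} x∈ =
    toWitness (Equivalence.from T-≡ (trans (sym (lookup∘tabulate _ x)) ([]=⇒lookup x∈)))

  ∈-tabulate-isYes⁺ : ∀ {x} → P x → x ∈ tabulate (λ y → ⌊ P? y ⌋)
  ∈-tabulate-isYes⁺ {x} px =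
    lookup⇒[]= x _ (trans (lookup∘tabulate _ x) (Equivalence.to T-≡ (fromWitness px)))

0<∣p∣⇒Nonempty : ∀ {N} (p : Subset N) → 0 < ∣ p ∣ → Nonempty p
0<∣p∣⇒Nonempty {N} p 0<∣p∣ with nonempty? p
... | yes p≢∅ = p≢∅
... | no  p≡∅ with Empty-unique p≡∅
... | refl = contradiction (∣⊥∣≡0 N) (≢-sym (<⇒≢ 0<∣p∣))

module _ {N r m : ℕ} (cV : Fin N → Fin r) (cP : Fin N → Fin m) where

  ∈Vcls⁻ : ∀ {i x} → x ∈ Vcls cV i → cV x ≡ i
  ∈Vcls⁻ = ∈-tabulate-isYes⁻ (λ y → cV y Fin.≟ _)

  ∈Pcls-own : ∀ x → x ∈ Pcls cV cP (cP x)
  ∈Pcls-own x = ∈-tabulate-isYes⁺ (λ y → cP y Fin.≟ cP x) refl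

  IntegralIn⇒⊆IntPart : ∀ {i j} → IntegralIn cV cP i j → Vcls cV i ⊆ IntPart cV cP j
  IntegralIn⇒⊆IntPart {i} {j} Vᵢ⊆Pⱼ {x} x∈Vᵢ =
    ∈-tabulate-isYes⁺ (λ y → Vcls cV (cV y) ⊆? Pcls cV cP j)
      (subst (λ k → Vcls cV k ⊆ Pcls cV cP j) (sym (∈Vcls⁻ x∈Vᵢ)) Vᵢ⊆Pⱼ)

  IntegralIn-distinct⇒⊆─ : ∀ {a b p} → a ≢ b → IntegralIn cV cP b p →
                           Vcls cV b ⊆ Pcls cV cP p ─ Vcls cV a
  IntegralIn-distinct⇒⊆─ a≢b Vb⊆Pp x∈Vb =
    x∈p∧x∉q⇒x∈p─q (Vb⊆Pp x∈Vb) (λ x∈Va → a≢b (trans (sym (∈Vcls⁻ x∈Va)) (∈Vcls⁻ x∈Vb)))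

  ¬IntegralIn⇒PartialIn : ∀ {i x} → x ∈ Vcls cV i → ¬ IntegralIn cV cP i (cP x) →
                          PartialIn cV cP i (cP x)
  ¬IntegralIn⇒PartialIn {x = x} x∈Vᵢ Vᵢ⊈Pₓ = (x , x∈p∩q⁺ (x∈Vᵢ , ∈Pcls-own x)) , Vᵢ⊈Pₓ

module _ {N r m : ℕ} (cV : Fin N → Fin r) (cP : Fin N → Fin m)
         (stable : Stable cV cP) (j : Fin m) where
  open Stable stable

  large⇒IntegralIn-own : ∀ {i x} → ∣ IntPart cV cP j ∣ < ∣ Vcls cV i ∣ →
                         x ∈ Vcls cV i → IntegralIn cV cP i (cP x)
  large⇒IntegralIn-own {i} {x} large x∈Vᵢ with Vcls cV i ⊆? Pcls cV cP (cP x)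
  ... | yes Vᵢ⊆Pₓ = Vᵢ⊆Pₓ
  ... | no  Vᵢ⊈Pₓ =
    contradiction (cond3 j i (cP x , ¬IntegralIn⇒PartialIn cV cP x∈Vᵢ Vᵢ⊈Pₓ)) (<⇒≱ large)

  large⇒¬IntegralIn : ∀ {i} → ∣ IntPart cV cP j ∣ < ∣ Vcls cV i ∣ → ¬ IntegralIn cV cP i j
  large⇒¬IntegralIn large Vᵢ⊆Pⱼ = <⇒≱ large (p⊆q⇒∣p∣≤∣q∣ (IntegralIn⇒⊆IntPart cV cP Vᵢ⊆Pⱼ))

  large⇒¬IntegralIn-same : ∀ {a b p} → a ≢ b → p ≢ j → ∣ IntPart cV cP j ∣ < ∣ Vcls cV b ∣ →
                           IntegralIn cV cP a p → ¬ IntegralIn cV cP b p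
  large⇒¬IntegralIn-same {a} {b} {p} a≢b p≢j large Va⊆Pp Vb⊆Pp = <⇒≱ large (begin
    ∣ Vcls cV b ∣                 ≤⟨ p⊆q⇒∣p∣≤∣q∣ (IntegralIn-distinct⇒⊆─ cV cP a≢b Vb⊆Pp) ⟩
    ∣ Pcls cV cP p ─ Vcls cV a ∣  ≤⟨ cond4 p a Va⊆Pp j (≢-sym p≢j) ⟩
    ∣ IntPart cV cP j ∣           ∎)
    where open ≤-Reasoning

¬-many-large-classes : ∀ {N r m} (cV : Fin N → Fin r) (cP : Fin N → Fin (suc m)) →
                       Stable cV cP → (j : Fin (suc m)) →
                       (ι : Fin (suc m) → Fin r) → Injective _≡_ _≡_ ι →
                       ¬ (∀ a → ∣ IntPart cV cP j ∣ < ∣ Vcls cV (ι a) ∣)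
¬-many-large-classes {m = m} cV cP stable j ι ι-injective large =
  let a , b , a<b , slot-eq = pigeonhole (n<1+n m) slot in clash a<b slot-eq
  where
  element : ∀ a → Nonempty (Vcls cV (ι a))
  element a = 0<∣p∣⇒Nonempty _ (≤-trans (s≤s z≤n) (large a))

  home : Fin (suc m) → Fin (suc m)
  home a = cP (proj₁ (element a))

  integral : ∀ a → IntegralIn cV cP (ι a) (home a)
  integral a = large⇒IntegralIn-own cV cP stable j (large a) (proj₂ (element a))

  j≢home : ∀ a → j ≢ home a
  j≢home a j≡home = large⇒¬IntegralIn cV cP stable j (large a)
                      (subst (IntegralIn cV cP (ι a)) (sym j≡home) (integral a))

  slot : Fin (suc m) → Fin m
  slot a = punchOut (j≢home a)

  clash : ∀ {a b} → a Fin.< b → ¬ slot a ≡ slot b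
  clash {a} {b} a<b slot-eq =
    large⇒¬IntegralIn-same cV cP stable j (Finₚ.<⇒≢ a<b ∘ ι-injective) (≢-sym (j≢home a))
      (large b) (integral a) (subst (IntegralIn cV cP (ι b)) (sym home-eq) (integral b))
    where
    home-eq : home a ≡ home b
    home-eq = punchOut-injective (j≢home a) (j≢home b) slot-eq

proposition2p4 : (r t N : ℕ) → 3 ≤ t → t ≤ r →
    (n : Fin r → ℕ) → (∀ i → 1 ≤ n i) →
    (∀ (i j : Fin r) → toℕ i ≤ toℕ j → n j ≤ n i) →
    (cV : Fin N → Fin r) → (∀ i → ∣ Vcls cV i ∣ ≡ n i) →
    (cP : Fin N → Fin (t ∸ 1)) → Stable cV cP →
    ∀ (j : Fin (t ∸ 1)) (k : Fin r) → toℕ k ≡ t ∸ 2 →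
    n k ≤ ∣ IntPart cV cP j ∣
proposition2p4 r (suc (suc (suc t))) N (s≤s (s≤s (s≤s _))) t≤r n _ n-antitone cV ∣Vᵢ∣≡nᵢ cP stable j k k≡t∸2 =
  decidable-stable (n k ≤? ∣ IntPart cV cP j ∣) λ nₖ≰ →
    ¬-many-large-classes cV cP stable j ι (inject≤-injective t∸1≤r t∸1≤r _ _)
      (λ a → <-≤-trans (≰⇒> nₖ≰) (nₖ≤∣Vᵢ∣ a))
  where
  t∸1≤r : suc (suc t) ≤ r
  t∸1≤r = ≤-trans (n≤1+n _) t≤r

  ι : Fin (suc (suc t)) → Fin r
  ι a = inject≤ a t∸1≤r

  nₖ≤∣Vᵢ∣ : ∀ a → n k ≤ ∣ Vcls cV (ι a) ∣
  nₖ≤∣Vᵢ∣ a = begin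
    n k               ≤⟨ n-antitone (ι a) k (begin
                           toℕ (ι a)  ≡⟨ toℕ-inject≤ a t∸1≤r ⟩
                           toℕ a      ≤⟨ ≤-pred (toℕ<n a) ⟩
                           suc t      ≡⟨ sym k≡t∸2 ⟩
                           toℕ k      ∎) ⟩
    n (ι a)           ≡⟨ sym (∣Vᵢ∣≡nᵢ (ι a)) ⟩
    ∣ Vcls cV (ι a) ∣  ∎
    where open ≤-Reasoning
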